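{- Every weakly graphic homogeneous relation is weakly digraphic. There exist weakly graphic homogeneous relations that are not modular quotient. There exist modular quotient homogeneous relations that are not weakly digraphic (hence not weakly graphic).
   Context: A diverse triple of a finite set $X$ is $(x,y,z)\in X^3$ with $x\neq y$, $x\neq z$, written $(x|yz)$. A homogeneous relation $H$ on $X$ is a relation on diverse triples such that for every $x\in X$ the relation $H_x(y,z)\Leftrightarrow H(x|yz)$ is an equivalence relation on $X\setminus\{x\}$. $M\subseteq X$ is a homogeneous module if $H(x|mm')$ for all $m,m'\in M$, $x\in X\setminus M$. $H$ is weakly graphic if $H(y|xz)\wedge H(z|xy)\Rightarrow H(x|yz)$ for all pairwise distinct $x,y,z$; weakly digraphic if $H(s|xy)\wedge H(t|xy)\wedge H(y|sx)\wedge H(y|tx)\Rightarrow H(x|st)$ for all $x,y,s,t$ (with diverse triples); modular quotient if for every homogeneous module $M$, all $x,y\in M$ and all $s,t\notin M$, $H(x|st)\Leftrightarrow H(y|st)$. -}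

module Defs where

open import Level using (0ℓ)
open import Data.Nat using (ℕ)
open import Data.Fin using (Fin)
open import Data.Fin.Subset using (Subset; _∈_; _∉_)
open import Data.Product using (_×_; Σ; ∃)
open import Relation.Nullary using (¬_)
open import Relation.Binary.PropositionalEquality using (_≡_; _≢_)

-- A ternary relation on X = Fin n; H x y z  stands for  H(x|yz).
-- Only its values on diverse triples (x ≢ y, x ≢ z) are ever consulted.
TernRel : ℕ → Set₁
TernRel n = Fin n → Fin n → Fin n → Set

record IsHomogeneous {n : ℕ} (H : TernRel n) : Set where
  field
    refl′  : ∀ x y → x ≢ y → H x y y
    sym′   : ∀ x y z → x ≢ y → x ≢ z → H x y z → H x z y
    trans′ : ∀ x y z w → x ≢ y → x ≢ z → x ≢ w →
             H x y z → H x z w → H x y w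

IsModule : {n : ℕ} → TernRel n → Subset n → Set
IsModule H M = ∀ x m m′ → m ∈ M → m′ ∈ M → x ∉ M → H x m m′

WeaklyGraphic : {n : ℕ} → TernRel n → Set
WeaklyGraphic H = ∀ x y z → x ≢ y → x ≢ z → y ≢ z →
  H y x z → H z x y → H x y z

WeaklyDigraphic : {n : ℕ} → TernRel n → Set
WeaklyDigraphic H = ∀ x y s t → x ≢ y → s ≢ x → s ≢ y → t ≢ x → t ≢ y →
  H s x y → H t x y → H y s x → H y t x → H x s t

ModularQuotient : {n : ℕ} → TernRel n → Set
ModularQuotient {n} H = ∀ (M : Subset n) → IsModule H M →
  ∀ x y s t → x ∈ M → y ∈ M → s ∉ M → t ∉ M →
  (H x s t → H y s t) × (H y s t → H x s t)

module Submission where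

open import Defs
open import Data.Nat as ℕ using (ℕ)
open import Data.Fin using (Fin; #_; _≟_)
open import Data.Fin.Properties using (all?)
open import Data.Fin.Subset using (Subset; _∈_; inside; outside)
open import Data.Fin.Subset.Properties using (_∈?_; anySubset?)
open import Data.Product using (_×_; Σ; _,_; proj₁)
open import Data.Unit using (tt)
open import Data.Vec using (Vec; []; _∷_; lookup; here; there)
open import Function using (_∘_)
open import Relation.Nullary using (¬_)
open import Relation.Nullary.Decidable
  using (Dec; ¬?; _×-dec_; _→-dec_; map′; decidable-stable; toWitness)
open import Relation.Binary.PropositionalEquality using (_≡_; refl; sym; trans; ≢-sym; _≢_)

-- In a weakly graphic relation, H(s|xy) ∧ H(y|sx) already gives H(x|ys); applying this to
-- s and to t, H(x|st) follows by transitivity of H_x. The two examples are relations read off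
-- colourings (H(x|yz) iff y and z get the same colour at x), checked by exhaustive search.

weaklyGraphic⇒weaklyDigraphic : (n : ℕ) (H : TernRel n) →
  IsHomogeneous H → WeaklyGraphic H → WeaklyDigraphic H
weaklyGraphic⇒weaklyDigraphic n H hom wg x y s t x≢y s≢x s≢y t≢x t≢y Hsxy Htxy Hysx Hytx =
  trans′ x s y t (≢-sym s≢x) x≢y (≢-sym t≢x)
    (sym′ x y s x≢y (≢-sym s≢x) (H[x|y·] s s≢x s≢y Hsxy Hysx))
    (H[x|y·] t t≢x t≢y Htxy Hytx)
  where
  open IsHomogeneous hom
  H[x|y·] : ∀ u → u ≢ x → u ≢ y → H u x y → H y u x → H x y u
  H[x|y·] u u≢x u≢y Huxy Hyux =
    wg x y u x≢y (≢-sym u≢x) (≢-sym u≢y) (sym′ y u x (≢-sym u≢y) (≢-sym x≢y) Hyux) Huxy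

allSubset? : {n : ℕ} {P : Subset n → Set} → (∀ M → Dec (P M)) → Dec (∀ M → P M)
allSubset? P? =
  map′ (λ ¬∃¬P M → decidable-stable (P? M) (λ ¬PM → ¬∃¬P (M , ¬PM)))
       (λ ∀P (M , ¬PM) → ¬PM (∀P M))
       (¬? (anySubset? (¬? ∘ P?)))

module Decide {n : ℕ} {H : TernRel n} (H? : ∀ x y z → Dec (H x y z)) where

  private
    _≢?_ : (x y : Fin n) → Dec (x ≢ y)
    x ≢? y = ¬? (x ≟ y)

    _∉?_ : (x : Fin n) (M : Subset n) → Dec (¬ x ∈ M)
    x ∉? M = ¬? (x ∈? M)

  weaklyGraphic? : Dec (WeaklyGraphic H)
  weaklyGraphic? =
    all? λ x → all? λ y → all? λ z →
    x ≢? y →-dec x ≢? z →-dec y ≢? z →-dec H? y x z →-dec H? z x y →-dec H? x y z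

  isModule? : ∀ M → Dec (IsModule H M)
  isModule? M =
    all? λ x → all? λ m → all? λ m′ →
    m ∈? M →-dec m′ ∈? M →-dec x ∉? M →-dec H? x m m′

  modularQuotient? : Dec (ModularQuotient H)
  modularQuotient? =
    allSubset? λ M → isModule? M →-dec
    (all? λ x → all? λ y → all? λ s → all? λ t →
     x ∈? M →-dec y ∈? M →-dec s ∉? M →-dec t ∉? M →-dec
     ((H? x s t →-dec H? y s t) ×-dec (H? y s t →-dec H? x s t)))

Colouring : ℕ → Set
Colouring n = Fin n → Fin n → ℕ

colouringRel : {n : ℕ} → Colouring n → TernRel n
colouringRel c x y z = c x y ≡ c x z

colouringRel-isHomogeneous : {n : ℕ} (c : Colouring n) → IsHomogeneous (colouringRel c)
colouringRel-isHomogeneous c = record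
  { refl′  = λ _ _ _ → refl
  ; sym′   = λ _ _ _ _ _ → sym
  ; trans′ = λ _ _ _ _ _ _ _ → trans
  }

colouringRel? : {n : ℕ} (c : Colouring n) → ∀ x y z → Dec (colouringRel c x y z)
colouringRel? c x y z = c x y ℕ.≟ c x z

-- Row x lists the colours c x y; the diagonal entry 9 is never consulted.
table : {n : ℕ} → Vec (Vec ℕ n) n → Colouring n
table rows x y = lookup (lookup rows x) y

graphicColouring : Colouring 4
graphicColouring = table
  ( (9 ∷ 1 ∷ 0 ∷ 0 ∷ [])
  ∷ (1 ∷ 9 ∷ 0 ∷ 0 ∷ [])
  ∷ (1 ∷ 1 ∷ 9 ∷ 0 ∷ [])
  ∷ (2 ∷ 1 ∷ 0 ∷ 9 ∷ [])
  ∷ [])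

quotientColouring : Colouring 5
quotientColouring = table
  ( (9 ∷ 0 ∷ 0 ∷ 0 ∷ 0 ∷ [])
  ∷ (0 ∷ 9 ∷ 0 ∷ 0 ∷ 0 ∷ [])
  ∷ (1 ∷ 1 ∷ 9 ∷ 0 ∷ 0 ∷ [])
  ∷ (0 ∷ 0 ∷ 1 ∷ 9 ∷ 0 ∷ [])
  ∷ (2 ∷ 2 ∷ 1 ∷ 0 ∷ 9 ∷ [])
  ∷ [])

graphicColouring-weaklyGraphic : WeaklyGraphic (colouringRel graphicColouring)
graphicColouring-weaklyGraphic =
  toWitness {a? = Decide.weaklyGraphic? (colouringRel? graphicColouring)} tt

graphicModule : Subset 4
graphicModule = outside ∷ outside ∷ inside ∷ inside ∷ []

graphicModule-isModule : IsModule (colouringRel graphicColouring) graphicModule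
graphicModule-isModule =
  toWitness {a? = Decide.isModule? (colouringRel? graphicColouring) graphicModule} tt

-- In the module {2, 3}, vertex 2 puts 0 and 1 in one class while 3 separates them.
graphicColouring-¬modularQuotient : ¬ ModularQuotient (colouringRel graphicColouring)
graphicColouring-¬modularQuotient mq
  with proj₁ (mq graphicModule graphicModule-isModule (# 2) (# 3) (# 0) (# 1)
                 (there (there here)) (there (there (there here))) (λ ()) (λ { (there ()) }))
             refl
... | ()

quotientColouring-modularQuotient : ModularQuotient (colouringRel quotientColouring)
quotientColouring-modularQuotient =
  toWitness {a? = Decide.modularQuotient? (colouringRel? quotientColouring)} tt

quotientColouring-¬weaklyDigraphic : ¬ WeaklyDigraphic (colouringRel quotientColouring)
quotientColouring-¬weaklyDigraphic wd
  with wd (# 4) (# 0) (# 1) (# 3) (λ ()) (λ ()) (λ ()) (λ ()) (λ ()) refl refl refl refl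
... | ()

proposition6 : ((n : ℕ) (H : TernRel n) → IsHomogeneous H → WeaklyGraphic H → WeaklyDigraphic H)
    × Σ ℕ (λ n → Σ (TernRel n) (λ H →
        IsHomogeneous H × WeaklyGraphic H × ¬ ModularQuotient H))
    × Σ ℕ (λ n → Σ (TernRel n) (λ H →
        IsHomogeneous H × ModularQuotient H × ¬ WeaklyDigraphic H × ¬ WeaklyGraphic H))
proposition6 =
    weaklyGraphic⇒weaklyDigraphic
  , (4 , colouringRel graphicColouring
       , colouringRel-isHomogeneous graphicColouring
       , graphicColouring-weaklyGraphic
       , graphicColouring-¬modularQuotient)
  , (5 , colouringRel quotientColouring
       , colouringRel-isHomogeneous quotientColouring
       , quotientColouring-modularQuotient
       , quotientColouring-¬weaklyDigraphic
       , quotientColouring-¬weaklyDigraphic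
         ∘ weaklyGraphic⇒weaklyDigraphic 5 _ (colouringRel-isHomogeneous quotientColouring))
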